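{- Let $a,b,c,d$ be non-negative integers satisfying $$P(a,b,c,d) := a^2+b^2+c^2+d^2-2ab-2ac-2ad-2bc-2bd-2cd-4abcd-4 = 0.$$ Then the product of any two of $a,b,c,d$ is one less than a perfect square, i.e. each of $ab+1$, $ac+1$, $ad+1$, $bc+1$, $bd+1$, $cd+1$ is the square of an integer. -}

module Defs where

open import Data.Nat using (ℕ)
open import Data.Integer using (ℤ; +_; _+_; _-_; _*_)
open import Data.Product using (∃)
open import Relation.Binary.PropositionalEquality using (_≡_)

P : ℤ → ℤ → ℤ → ℤ → ℤ
P a b c d =
  a * a + b * b + c * c + d * d
  - + 2 * a * b - + 2 * a * c - + 2 * a * d
  - + 2 * b * c - + 2 * b * d - + 2 * c * d
  - + 4 * a * b * c * d - + 4

IsSquare : ℤ → Set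
IsSquare z = ∃ λ (k : ℤ) → z ≡ k * k

-- Vieta jumping. As a quadratic in d, P(a,b,c,d) = 0 has the roots d and
-- e = 2(a+b+c+2abc) - d, with de = a²+b²+c² - 2(ab+bc+ca) - 4. For 1 ≤ a ≤ b ≤ c ≤ d no root
-- exceeds 2(a+b+c+2abc), so e ≥ 0, and de < c² ≤ d² gives e < d: (a,b,c,e) is a smaller
-- solution, whose products plus one are squares by induction. P also splits along each
-- pairing of its variables, P(a,b,c,d) = (b+c-a-d)² - 4(bc+1)(ad+1). With bc+1 = u² and
-- ae+1 = t² this gives (b+c-a-e)² = (2ut)², and since (b+c-a-d) + (b+c-a-e) = -4au², also
-- b+c-a-d = 2uv for an integer v, whence ad+1 = v²; likewise for bd+1 and cd+1. A solution
-- with a = 0 has (b+c-d)² = 4(bc+1), so bc+1 is a square.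
module Submission where

open import Defs
open import Data.Nat using (ℕ)
open import Data.Integer using (ℤ; +_; _+_; _*_)
open import Data.Product using (_×_)
open import Relation.Binary.PropositionalEquality using (_≡_)

import Algebra.Properties.CommutativeSemigroup as CommutativeSemigroupProperties
open import Data.Integer.Base using (0ℤ; -_; _-_; ∣_∣; ≢-nonZero)
import Data.Integer.Properties as ℤ
import Data.Integer.Tactic.RingSolver as ℤ-Solver
open import Data.Nat.Base as ℕ using (zero; suc; _∸_; _≤_; _<_)
open import Data.Nat.Divisibility using (_∣_; divides)
open import Data.Nat.Primality using (euclidsLemma; prime[2])
import Data.Nat.Properties as ℕ
import Data.Nat.Tactic.RingSolver as ℕ-Solver
open import Data.Product using (∃; _,_)
open import Data.Sum as Sum using (_⊎_; inj₁; inj₂; [_,_]′; reduce)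
open import Function using (_⇔_; mk⇔; Equivalence)
open import Relation.Binary.PropositionalEquality
  using (refl; sym; trans; cong; cong₂; subst; _≢_; module ≡-Reasoning)
open import Tactic.RingSolver.NonReflective ℤ-Solver.ring
  using (Expr; Κ; _⊕_; _⊗_; ⊝_; solve; _⊜_)

module +-Semigroup = CommutativeSemigroupProperties ℕ.+-commutativeSemigroup

i*i≡j*j⇒i≡j⊎i≡-j : ∀ i j → i * i ≡ j * j → i ≡ j ⊎ i ≡ - j
i*i≡j*j⇒i≡j⊎i≡-j i j eq =
  Sum.map (ℤ.i-j≡0⇒i≡j i j)
          (λ i+j≡0 → ℤ.i-j≡0⇒i≡j i (- j) (trans (cong (_+_ i) (ℤ.neg-involutive j)) i+j≡0))
          (ℤ.i*j≡0⇒i≡0∨j≡0 (i - j) (trans (difference-of-squares i j) (ℤ.i≡j⇒i-j≡0 eq)))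
  where
  difference-of-squares : ∀ i j → (i - j) * (i + j) ≡ i * i - j * j
  difference-of-squares = ℤ-Solver.solve-∀

i*i≡[k*j]²⇒k∣i : ∀ i k j → i * i ≡ (k * j) * (k * j) → ∃ λ s → i ≡ k * s
i*i≡[k*j]²⇒k∣i i k j eq =
  [ (λ i≡kj → j , i≡kj) , (λ i≡-kj → - j , trans i≡-kj (ℤ.neg-distribʳ-* k j)) ]′
  (i*i≡j*j⇒i≡j⊎i≡-j i (k * j) eq)

[2*u*v]²≡4*u²*v² : ∀ u v → (+ 2 * u * v) * (+ 2 * u * v) ≡ + 4 * (u * u) * (v * v)
[2*u*v]²≡4*u²*v² = ℤ-Solver.solve-∀

n*n≡4*k⇒k≡m*m : ∀ n k → n ℕ.* n ≡ 4 ℕ.* k → ∃ λ m → k ≡ m ℕ.* m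
n*n≡4*k⇒k≡m*m n k eq =
  halve (reduce (euclidsLemma n n prime[2] (divides (2 ℕ.* k) (trans eq (4k≡2k*2 k)))))
  where
  4k≡2k*2 : ∀ k → 4 ℕ.* k ≡ 2 ℕ.* k ℕ.* 2
  4k≡2k*2 = ℕ-Solver.solve-∀
  [m*2]²≡4*m² : ∀ m → m ℕ.* 2 ℕ.* (m ℕ.* 2) ≡ 4 ℕ.* (m ℕ.* m)
  [m*2]²≡4*m² = ℕ-Solver.solve-∀
  halve : 2 ∣ n → ∃ λ m → k ≡ m ℕ.* m
  halve (divides m n≡m*2) = m , ℕ.*-cancelˡ-≡ k (m ℕ.* m) 4
    (trans (sym eq) (trans (cong (λ r → r ℕ.* r) n≡m*2) ([m*2]²≡4*m² m)))

pos-IsSquare : ∀ n → (∃ λ m → n ≡ m ℕ.* m) → IsSquare (+ n)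
pos-IsSquare n (m , n≡m*m) = + m , trans (cong +_ n≡m*m) (ℤ.pos-* m m)

i*i≡4*n⇒IsSquare : ∀ i n → i * i ≡ + 4 * + n → IsSquare (+ n)
i*i≡4*n⇒IsSquare i n eq = pos-IsSquare n (n*n≡4*k⇒k≡m*m ∣ i ∣ n
  (trans (sym (ℤ.∣i*j∣≡∣i∣*∣j∣ i i)) (trans (cong ∣_∣ eq) (ℤ.∣i*j∣≡∣i∣*∣j∣ (+ 4) (+ n)))))

-- P as a ring-solver expression: its denotation is P by definition, so the solver
-- proves identities about P itself.
P̂ : ∀ {n} → Expr ℤ n → Expr ℤ n → Expr ℤ n → Expr ℤ n → Expr ℤ n
P̂ a b c d =
  a ⊗ a ⊕ b ⊗ b ⊕ c ⊗ c ⊕ d ⊗ d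
  ⊕ ⊝ (Κ (+ 2) ⊗ a ⊗ b) ⊕ ⊝ (Κ (+ 2) ⊗ a ⊗ c) ⊕ ⊝ (Κ (+ 2) ⊗ a ⊗ d)
  ⊕ ⊝ (Κ (+ 2) ⊗ b ⊗ c) ⊕ ⊝ (Κ (+ 2) ⊗ b ⊗ d) ⊕ ⊝ (Κ (+ 2) ⊗ c ⊗ d)
  ⊕ ⊝ (Κ (+ 4) ⊗ a ⊗ b ⊗ c ⊗ d) ⊕ ⊝ Κ (+ 4)

P-swap₁₂ : ∀ x y z w → P x y z w ≡ P y x z w
P-swap₁₂ = solve 4 (λ x y z w → P̂ x y z w ⊜ P̂ y x z w) refl

P-swap₂₃ : ∀ x y z w → P x y z w ≡ P x z y w
P-swap₂₃ = solve 4 (λ x y z w → P̂ x y z w ⊜ P̂ x z y w) refl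

P-swap₃₄ : ∀ x y z w → P x y z w ≡ P x y w z
P-swap₃₄ = solve 4 (λ x y z w → P̂ x y z w ⊜ P̂ x y w z) refl

P-pairing : ∀ x y z w →
  P x y z w ≡ (y + z - x - w) * (y + z - x - w) - + 4 * (y * z + + 1) * (x * w + + 1)
P-pairing = solve 4 (λ x y z w → P̂ x y z w ⊜
  (D y z x w ⊗ D y z x w ⊕ ⊝ (Κ (+ 4) ⊗ (y ⊗ z ⊕ Κ (+ 1)) ⊗ (x ⊗ w ⊕ Κ (+ 1))))) refl
  where
  D : ∀ {n} → Expr ℤ n → Expr ℤ n → Expr ℤ n → Expr ℤ n → Expr ℤ n
  D y z x w = y ⊕ z ⊕ ⊝ x ⊕ ⊝ w

P-quadratic : ∀ x y z w →
  P x y z w ≡ (w * w + (x * x + y * y + z * z))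
            - (+ 2 * (x + y + z + + 2 * x * y * z) * w + (+ 2 * (x * y + y * z + z * x) + + 4))
P-quadratic = solve 4 (λ x y z w → P̂ x y z w ⊜
  (w ⊗ w ⊕ (x ⊗ x ⊕ y ⊗ y ⊕ z ⊗ z)
   ⊕ ⊝ (Κ (+ 2) ⊗ (x ⊕ y ⊕ z ⊕ Κ (+ 2) ⊗ x ⊗ y ⊗ z) ⊗ w
        ⊕ (Κ (+ 2) ⊗ (x ⊗ y ⊕ y ⊗ z ⊕ z ⊗ x) ⊕ Κ (+ 4))))) refl

P≡0⇒pairing : ∀ x y z w → P x y z w ≡ 0ℤ →
  (y + z - x - w) * (y + z - x - w) ≡ + 4 * (y * z + + 1) * (x * w + + 1)
P≡0⇒pairing x y z w P≡0 = ℤ.i-j≡0⇒i≡j _ _ (trans (sym (P-pairing x y z w)) P≡0)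

square-from-conjugate : ∀ x u t n Z W → u * u ≢ 0ℤ →
  Z ≡ - (+ 4 * x * (u * u)) - W → W * W ≡ (+ 2 * u * t) * (+ 2 * u * t) →
  Z * Z ≡ + 4 * (u * u) * n → IsSquare n
square-from-conjugate x u t n Z W u²≢0 Z≡-4xu²-W W² Z² with i*i≡[k*j]²⇒k∣i W (+ 2 * u) t W²
... | s , W≡2us = v , ℤ.*-cancelˡ-≡ (+ 4 * (u * u)) n (v * v) {{≢-nonZero 4u²≢0}} (begin
    + 4 * (u * u) * n              ≡⟨ Z² ⟨
    Z * Z                          ≡⟨ cong (λ r → r * r) Z≡2uv ⟩
    (+ 2 * u * v) * (+ 2 * u * v)  ≡⟨ [2*u*v]²≡4*u²*v² u v ⟩
    + 4 * (u * u) * (v * v)        ∎)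
  where
  open ≡-Reasoning
  v : ℤ
  v = - (+ 2 * x * u + s)
  factor : ∀ x u s → - (+ 4 * x * (u * u)) - + 2 * u * s ≡ + 2 * u * (- (+ 2 * x * u + s))
  factor = ℤ-Solver.solve-∀
  Z≡2uv : Z ≡ + 2 * u * v
  Z≡2uv = trans Z≡-4xu²-W (trans (cong (_-_ (- (+ 4 * x * (u * u)))) W≡2us) (factor x u s))
  4u²≢0 : + 4 * (u * u) ≢ 0ℤ
  4u²≢0 eq = [ (λ ()) , u²≢0 ]′ (ℤ.i*j≡0⇒i≡0∨j≡0 (+ 4) eq)

vieta-conjugate : ∀ x y z d e → d + e ≡ + 2 * (x + y + z + + 2 * x * y * z) →
  y + z - x - d ≡ - (+ 4 * x * (y * z + + 1)) - (y + z - x - e)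
vieta-conjugate x y z d e d+e≡ = begin
  y + z - x - d
    ≡⟨ regroup x y z d e ⟩
  + 2 * (y + z - x) - (d + e) - (y + z - x - e)
    ≡⟨ cong (λ r → + 2 * (y + z - x) - r - (y + z - x - e)) d+e≡ ⟩
  + 2 * (y + z - x) - + 2 * (x + y + z + + 2 * x * y * z) - (y + z - x - e)
    ≡⟨ simplify x y z e ⟩
  - (+ 4 * x * (y * z + + 1)) - (y + z - x - e) ∎
  where
  open ≡-Reasoning
  regroup : ∀ x y z d e → y + z - x - d ≡ + 2 * (y + z - x) - (d + e) - (y + z - x - e)
  regroup = ℤ-Solver.solve-∀
  simplify : ∀ x y z e → + 2 * (y + z - x) - + 2 * (x + y + z + + 2 * x * y * z) - (y + z - x - e)
                       ≡ - (+ 4 * x * (y * z + + 1)) - (y + z - x - e)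
  simplify = ℤ-Solver.solve-∀

vieta-jump : ∀ x y z d e → y * z + + 1 ≢ 0ℤ →
  P x y z d ≡ 0ℤ → P x y z e ≡ 0ℤ → d + e ≡ + 2 * (x + y + z + + 2 * x * y * z) →
  IsSquare (y * z + + 1) → IsSquare (x * e + + 1) → IsSquare (x * d + + 1)
vieta-jump x y z d e yz+1≢0 Pd≡0 Pe≡0 d+e≡ (u , yz+1≡u²) (t , xe+1≡t²) =
  square-from-conjugate x u t (x * d + + 1) Z W (subst (_≢ 0ℤ) yz+1≡u² yz+1≢0) Z≡ W² Z²
  where
  open ≡-Reasoning
  Z W : ℤ
  Z = y + z - x - d
  W = y + z - x - e
  Z≡ : Z ≡ - (+ 4 * x * (u * u)) - W
  Z≡ = subst (λ q → Z ≡ - (+ 4 * x * q) - W) yz+1≡u² (vieta-conjugate x y z d e d+e≡)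
  Z² : Z * Z ≡ + 4 * (u * u) * (x * d + + 1)
  Z² = subst (λ q → Z * Z ≡ + 4 * q * (x * d + + 1)) yz+1≡u² (P≡0⇒pairing x y z d Pd≡0)
  W² : W * W ≡ (+ 2 * u * t) * (+ 2 * u * t)
  W² = begin
    W * W                                ≡⟨ P≡0⇒pairing x y z e Pe≡0 ⟩
    + 4 * (y * z + + 1) * (x * e + + 1)  ≡⟨ cong₂ (λ q r → + 4 * q * r) yz+1≡u² xe+1≡t² ⟩
    + 4 * (u * u) * (t * t)              ≡⟨ [2*u*v]²≡4*u²*v² u t ⟨
    (+ 2 * u * t) * (+ 2 * u * t)        ∎

centre : ℕ → ℕ → ℕ → ℕ
centre a b c = a ℕ.+ b ℕ.+ c ℕ.+ 2 ℕ.* a ℕ.* b ℕ.* c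

squares : ℕ → ℕ → ℕ → ℕ
squares a b c = a ℕ.* a ℕ.+ b ℕ.* b ℕ.+ c ℕ.* c

pairs : ℕ → ℕ → ℕ → ℕ
pairs a b c = a ℕ.* b ℕ.+ b ℕ.* c ℕ.+ c ℕ.* a

-- P (a, b, c, d) = 0 with the negative terms moved across, read as a quadratic equation in d.
IsRoot : ℕ → ℕ → ℕ → ℕ → Set
IsRoot a b c d = d ℕ.* d ℕ.+ squares a b c ≡ 2 ℕ.* centre a b c ℕ.* d ℕ.+ (2 ℕ.* pairs a b c ℕ.+ 4)

pos-twice-centre : ∀ a b c → + (2 ℕ.* centre a b c) ≡ + 2 * (+ a + + b + + c + + 2 * + a * + b * + c)
pos-twice-centre a b c =
  trans (ℤ.pos-* 2 (centre a b c)) (cong (λ r → + 2 * (+ (a ℕ.+ b ℕ.+ c) + r)) pos-2abc)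
  where
  pos-2abc : + (2 ℕ.* a ℕ.* b ℕ.* c) ≡ + 2 * + a * + b * + c
  pos-2abc = trans (ℤ.pos-* (2 ℕ.* a ℕ.* b) c)
    (cong (_* + c) (trans (ℤ.pos-* (2 ℕ.* a) b) (cong (_* + b) (ℤ.pos-* 2 a))))

P≡0⇔IsRoot : ∀ a b c d → P (+ a) (+ b) (+ c) (+ d) ≡ 0ℤ ⇔ IsRoot a b c d
P≡0⇔IsRoot a b c d = mk⇔
  (λ P≡0 → ℤ.+-injective (ℤ.i-j≡0⇒i≡j _ _ (trans (sym P≡lhs-rhs) P≡0)))
  (λ root → trans P≡lhs-rhs (ℤ.i≡j⇒i-j≡0 (cong +_ root)))
  where
  lhs : + (d ℕ.* d ℕ.+ squares a b c) ≡ + d * + d + (+ a * + a + + b * + b + + c * + c)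
  lhs = cong₂ _+_ (ℤ.pos-* d d) (cong₂ _+_ (cong₂ _+_ (ℤ.pos-* a a) (ℤ.pos-* b b)) (ℤ.pos-* c c))
  rhs : + (2 ℕ.* centre a b c ℕ.* d ℕ.+ (2 ℕ.* pairs a b c ℕ.+ 4))
      ≡ + 2 * (+ a + + b + + c + + 2 * + a * + b * + c) * + d
        + (+ 2 * (+ a * + b + + b * + c + + c * + a) + + 4)
  rhs = cong₂ _+_ (trans (ℤ.pos-* (2 ℕ.* centre a b c) d) (cong (_* + d) (pos-twice-centre a b c)))
    (cong (_+ + 4) (trans (ℤ.pos-* 2 (pairs a b c)) (cong (_*_ (+ 2))
      (cong₂ _+_ (cong₂ _+_ (ℤ.pos-* a b) (ℤ.pos-* b c)) (ℤ.pos-* c a)))))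
  P≡lhs-rhs : P (+ a) (+ b) (+ c) (+ d)
            ≡ + (d ℕ.* d ℕ.+ squares a b c) - + (2 ℕ.* centre a b c ℕ.* d ℕ.+ (2 ℕ.* pairs a b c ℕ.+ 4))
  P≡lhs-rhs = trans (P-quadratic (+ a) (+ b) (+ c) (+ d)) (cong₂ _-_ (sym lhs) (sym rhs))

root⇔product : ∀ {s k m d e} → d ℕ.+ e ≡ s →
  (d ℕ.* d ℕ.+ k ≡ s ℕ.* d ℕ.+ m) ⇔ (k ≡ e ℕ.* d ℕ.+ m)
root⇔product {k = k} {m} {d} {e} refl = mk⇔
  (λ root → ℕ.+-cancelˡ-≡ (d ℕ.* d) k (e ℕ.* d ℕ.+ m) (trans root (expand d e m)))
  (λ product → trans (cong (λ n → d ℕ.* d ℕ.+ n) product) (sym (expand d e m)))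
  where
  expand : ∀ d e m → (d ℕ.+ e) ℕ.* d ℕ.+ m ≡ d ℕ.* d ℕ.+ (e ℕ.* d ℕ.+ m)
  expand = ℕ-Solver.solve-∀

IsRoot⇒product : ∀ a b c d e → d ℕ.+ e ≡ 2 ℕ.* centre a b c → IsRoot a b c d →
  squares a b c ≡ e ℕ.* d ℕ.+ (2 ℕ.* pairs a b c ℕ.+ 4)
IsRoot⇒product _ _ _ _ _ d+e≡ = Equivalence.to (root⇔product d+e≡)

other-root : ∀ a b c d e → d ℕ.+ e ≡ 2 ℕ.* centre a b c → IsRoot a b c d → IsRoot a b c e
other-root a b c d e d+e≡ root = Equivalence.from (root⇔product (trans (ℕ.+-comm e d) d+e≡))
  (trans (IsRoot⇒product a b c d e d+e≡ root) (cong (ℕ._+ (2 ℕ.* pairs a b c ℕ.+ 4)) (ℕ.*-comm e d)))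

2*pairs+4≤2*centre+squares : ∀ {a b c} → 0 < a → 0 < b → 0 < c →
  2 ℕ.* pairs a b c ℕ.+ 4 ≤ 2 ℕ.* centre a b c ℕ.+ squares a b c
2*pairs+4≤2*centre+squares {a@(suc x)} {b@(suc y)} {c@(suc z)} _ _ _ =
  subst (2 ℕ.* pairs a b c ℕ.+ 4 ≤_) (sym (excess x y z)) (ℕ.m≤m+n _ _)
  where
  excess : ∀ x y z →
    2 ℕ.* ((1 ℕ.+ x) ℕ.+ (1 ℕ.+ y) ℕ.+ (1 ℕ.+ z) ℕ.+ 2 ℕ.* (1 ℕ.+ x) ℕ.* (1 ℕ.+ y) ℕ.* (1 ℕ.+ z))
      ℕ.+ ((1 ℕ.+ x) ℕ.* (1 ℕ.+ x) ℕ.+ (1 ℕ.+ y) ℕ.* (1 ℕ.+ y) ℕ.+ (1 ℕ.+ z) ℕ.* (1 ℕ.+ z))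
    ≡ 2 ℕ.* ((1 ℕ.+ x) ℕ.* (1 ℕ.+ y) ℕ.+ (1 ℕ.+ y) ℕ.* (1 ℕ.+ z) ℕ.+ (1 ℕ.+ z) ℕ.* (1 ℕ.+ x)) ℕ.+ 4
      ℕ.+ (3 ℕ.+ (x ℕ.+ y ℕ.+ z) ℕ.* (x ℕ.+ y ℕ.+ z) ℕ.+ 4 ℕ.* (x ℕ.+ y ℕ.+ z) ℕ.+ 4 ℕ.* x ℕ.* y ℕ.* z)
  excess = ℕ-Solver.solve-∀

root≤2*centre : ∀ a b c d → 0 < a → 0 < b → 0 < c → IsRoot a b c d → d ≤ 2 ℕ.* centre a b c
root≤2*centre a b c d 0<a 0<b 0<c root = ℕ.≮⇒≥ λ s<d → ℕ.<-irrefl refl (begin-strict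
  m            ≤⟨ 2*pairs+4≤2*centre+squares 0<a 0<b 0<c ⟩
  s ℕ.+ k      <⟨ ℕ.+-monoˡ-< k s<d ⟩
  d ℕ.+ k      ≤⟨ ℕ.+-cancelˡ-≤ (s ℕ.* d) (d ℕ.+ k) m (sd+d+k≤sd+m s<d) ⟩
  m            ∎)
  where
  open ℕ.≤-Reasoning
  s k m : ℕ
  s = 2 ℕ.* centre a b c
  k = squares a b c
  m = 2 ℕ.* pairs a b c ℕ.+ 4
  sd+d+k≤sd+m : s < d → s ℕ.* d ℕ.+ (d ℕ.+ k) ≤ s ℕ.* d ℕ.+ m
  sd+d+k≤sd+m s<d = begin
    s ℕ.* d ℕ.+ (d ℕ.+ k)   ≡⟨ ℕ.+-assoc (s ℕ.* d) d k ⟨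
    s ℕ.* d ℕ.+ d ℕ.+ k     ≡⟨ cong (ℕ._+ k) (ℕ.+-comm (s ℕ.* d) d) ⟩
    suc s ℕ.* d ℕ.+ k       ≤⟨ ℕ.+-monoˡ-≤ k (ℕ.*-monoˡ-≤ d s<d) ⟩
    d ℕ.* d ℕ.+ k           ≡⟨ root ⟩
    s ℕ.* d ℕ.+ m           ∎

other-root<root : ∀ a b c d e → a ≤ c → b ≤ c → c ≤ d →
  squares a b c ≡ e ℕ.* d ℕ.+ (2 ℕ.* pairs a b c ℕ.+ 4) → e < d
other-root<root a b c d e a≤c b≤c c≤d product = ℕ.≰⇒> λ d≤e → ℕ.<-irrefl refl (begin-strict
  squares a b c                              ≤⟨ ℕ.+-mono-≤ a²+b²≤pairs (ℕ.*-mono-≤ (ℕ.≤-trans c≤d d≤e) c≤d) ⟩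
  pairs a b c ℕ.+ e ℕ.* d                    ≡⟨ ℕ.+-comm (pairs a b c) (e ℕ.* d) ⟩
  e ℕ.* d ℕ.+ pairs a b c                    <⟨ ℕ.+-monoʳ-< (e ℕ.* d) pairs<2*pairs+4 ⟩
  e ℕ.* d ℕ.+ (2 ℕ.* pairs a b c ℕ.+ 4)      ≡⟨ product ⟨
  squares a b c                              ∎)
  where
  open ℕ.≤-Reasoning
  a²+b²≤pairs : a ℕ.* a ℕ.+ b ℕ.* b ≤ pairs a b c
  a²+b²≤pairs = begin
    a ℕ.* a ℕ.+ b ℕ.* b                 ≤⟨ ℕ.+-mono-≤ (ℕ.*-monoˡ-≤ a a≤c) (ℕ.*-monoʳ-≤ b b≤c) ⟩
    c ℕ.* a ℕ.+ b ℕ.* c                 ≡⟨ ℕ.+-comm (c ℕ.* a) (b ℕ.* c) ⟩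
    b ℕ.* c ℕ.+ c ℕ.* a                 ≤⟨ ℕ.m≤n+m _ (a ℕ.* b) ⟩
    a ℕ.* b ℕ.+ (b ℕ.* c ℕ.+ c ℕ.* a)   ≡⟨ ℕ.+-assoc (a ℕ.* b) (b ℕ.* c) (c ℕ.* a) ⟨
    pairs a b c                          ∎
  pairs<2*pairs+4 : pairs a b c < 2 ℕ.* pairs a b c ℕ.+ 4
  pairs<2*pairs+4 = ℕ.≤-<-trans (ℕ.m≤n*m (pairs a b c) 2) (ℕ.m<m+n (2 ℕ.* pairs a b c) ℕ.z<s)

pos-*-+1 : ∀ m n → + (m ℕ.* n ℕ.+ 1) ≡ + m * + n + + 1
pos-*-+1 m n = cong (_+ + 1) (ℤ.pos-* m n)

product+1≢0 : ∀ m n → + m * + n + + 1 ≢ 0ℤ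
product+1≢0 m n eq = ℕ.m+1+n≢0 (m ℕ.* n) (ℤ.+-injective (trans (pos-*-+1 m n) eq))

P-zero⇒IsSquare : ∀ b c d → P 0ℤ (+ b) (+ c) (+ d) ≡ 0ℤ → IsSquare (+ b * + c + + 1)
P-zero⇒IsSquare b c d P≡0 =
  subst IsSquare (pos-*-+1 b c) (i*i≡4*n⇒IsSquare (+ b + + c - 0ℤ - + d) (b ℕ.* c ℕ.+ 1)
  (trans (P≡0⇒pairing 0ℤ (+ b) (+ c) (+ d) P≡0)
         (trans (ℤ.*-identityʳ (+ 4 * (+ b * + c + + 1))) (cong (_*_ (+ 4)) (sym (pos-*-+1 b c))))))

ProductsPlusOneSquare : ℕ → ℕ → ℕ → ℕ → Set
ProductsPlusOneSquare a b c d =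
  IsSquare (+ a * + b + + 1) × IsSquare (+ a * + c + + 1) × IsSquare (+ a * + d + + 1) ×
  IsSquare (+ b * + c + + 1) × IsSquare (+ b * + d + + 1) × IsSquare (+ c * + d + + 1)

IsSquare-*-comm : ∀ i j → IsSquare (i * j + + 1) → IsSquare (j * i + + 1)
IsSquare-*-comm i j = subst (λ k → IsSquare (k + + 1)) (ℤ.*-comm i j)

ProductsPlusOneSquare-swap₁₂ : ∀ a b c d → ProductsPlusOneSquare b a c d → ProductsPlusOneSquare a b c d
ProductsPlusOneSquare-swap₁₂ a b _ _ (ba , bc , bd , ac , ad , cd) =
  IsSquare-*-comm (+ b) (+ a) ba , ac , ad , bc , bd , cd

ProductsPlusOneSquare-swap₂₃ : ∀ a b c d → ProductsPlusOneSquare a c b d → ProductsPlusOneSquare a b c d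
ProductsPlusOneSquare-swap₂₃ _ b c _ (ac , ab , ad , cb , cd , bd) =
  ab , ac , ad , IsSquare-*-comm (+ c) (+ b) cb , bd , cd

ProductsPlusOneSquare-swap₃₄ : ∀ a b c d → ProductsPlusOneSquare a b d c → ProductsPlusOneSquare a b c d
ProductsPlusOneSquare-swap₃₄ _ _ c d (ab , ad , ac , bd , bc , dc) =
  ab , ac , ad , bc , bd , IsSquare-*-comm (+ d) (+ c) dc

ProductsPlusOneSquare-zero : ∀ b c d → P 0ℤ (+ b) (+ c) (+ d) ≡ 0ℤ → ProductsPlusOneSquare 0 b c d
ProductsPlusOneSquare-zero b c d P≡0 =
  (+ 1 , refl) , (+ 1 , refl) , (+ 1 , refl) ,
  P-zero⇒IsSquare b c d P≡0 ,
  P-zero⇒IsSquare b d c (trans (sym (P-swap₃₄ 0ℤ (+ b) (+ c) (+ d))) P≡0) ,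
  P-zero⇒IsSquare c d b
    (trans (sym (P-swap₃₄ 0ℤ (+ c) (+ b) (+ d))) (trans (sym (P-swap₂₃ 0ℤ (+ b) (+ c) (+ d))) P≡0))

ProductsPlusOneSquare-jump : ∀ a b c d e →
  P (+ a) (+ b) (+ c) (+ d) ≡ 0ℤ → P (+ a) (+ b) (+ c) (+ e) ≡ 0ℤ → d ℕ.+ e ≡ 2 ℕ.* centre a b c →
  ProductsPlusOneSquare a b c e → ProductsPlusOneSquare a b c d
ProductsPlusOneSquare-jump a b c d e Pd≡0 Pe≡0 d+e≡ (ab , ac , ae , bc , be , ce) =
  ab , ac ,
  vieta-jump (+ a) (+ b) (+ c) (+ d) (+ e) (product+1≢0 b c) Pd≡0 Pe≡0 sum bc ae ,
  bc ,
  vieta-jump (+ b) (+ a) (+ c) (+ d) (+ e) (product+1≢0 a c) (swap Pd≡0) (swap Pe≡0)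
    (trans sum (centre-swap (+ a) (+ b) (+ c))) ac be ,
  vieta-jump (+ c) (+ a) (+ b) (+ d) (+ e) (product+1≢0 a b) (rotate Pd≡0) (rotate Pe≡0)
    (trans sum (centre-rotate (+ a) (+ b) (+ c))) ab ce
  where
  sum : + d + + e ≡ + 2 * (+ a + + b + + c + + 2 * + a * + b * + c)
  sum = trans (cong +_ d+e≡) (pos-twice-centre a b c)
  swap : ∀ {w} → P (+ a) (+ b) (+ c) w ≡ 0ℤ → P (+ b) (+ a) (+ c) w ≡ 0ℤ
  swap {w} = trans (P-swap₁₂ (+ b) (+ a) (+ c) w)
  rotate : ∀ {w} → P (+ a) (+ b) (+ c) w ≡ 0ℤ → P (+ c) (+ a) (+ b) w ≡ 0ℤ
  rotate {w} P≡0 =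
    trans (sym (P-swap₁₂ (+ a) (+ c) (+ b) w)) (trans (sym (P-swap₂₃ (+ a) (+ b) (+ c) w)) P≡0)
  centre-swap : ∀ x y z → + 2 * (x + y + z + + 2 * x * y * z) ≡ + 2 * (y + x + z + + 2 * y * x * z)
  centre-swap = ℤ-Solver.solve-∀
  centre-rotate : ∀ x y z → + 2 * (x + y + z + + 2 * x * y * z) ≡ + 2 * (z + x + y + + 2 * z * x * y)
  centre-rotate = ℤ-Solver.solve-∀

module _ {ℓ} (R : ℕ → ℕ → ℕ → ℕ → Set ℓ)
  (swap₁₂ : ∀ a b c d → R b a c d → R a b c d)
  (swap₂₃ : ∀ a b c d → R a c b d → R a b c d)
  (swap₃₄ : ∀ a b c d → R a b d c → R a b c d)
  (sorted : ∀ {a b c d} → a ≤ b → b ≤ c → c ≤ d → R a b c d)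
  where

  private
    insert₁ : ∀ a {b c d} → b ≤ c → c ≤ d → R a b c d
    insert₁ a {b} {c} {d} b≤c c≤d with ℕ.≤-total a b | ℕ.≤-total a c | ℕ.≤-total a d
    ... | inj₁ a≤b | _        | _        = sorted a≤b b≤c c≤d
    ... | inj₂ b≤a | inj₁ a≤c | _        = swap₁₂ a b c d (sorted b≤a a≤c c≤d)
    ... | inj₂ _   | inj₂ c≤a | inj₁ a≤d = swap₁₂ a b c d (swap₂₃ b a c d (sorted b≤c c≤a a≤d))
    ... | inj₂ _   | inj₂ _   | inj₂ d≤a =
      swap₁₂ a b c d (swap₂₃ b a c d (swap₃₄ b c a d (sorted b≤c c≤d d≤a)))

    insert₂ : ∀ a b {c d} → c ≤ d → R a b c d
    insert₂ a b {c} {d} c≤d with ℕ.≤-total b c | ℕ.≤-total b d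
    ... | inj₁ b≤c | _        = insert₁ a b≤c c≤d
    ... | inj₂ c≤b | inj₁ b≤d = swap₂₃ a b c d (insert₁ a c≤b b≤d)
    ... | inj₂ _   | inj₂ d≤b = swap₂₃ a b c d (swap₃₄ a c b d (insert₁ a c≤d d≤b))

  wlog-sorted : ∀ a b c d → R a b c d
  wlog-sorted a b c d with ℕ.≤-total c d
  ... | inj₁ c≤d = insert₂ a b c≤d
  ... | inj₂ d≤c = swap₃₄ a b c d (insert₂ a b d≤c)

BoundedClaim : ℕ → ℕ → ℕ → ℕ → ℕ → Set
BoundedClaim n a b c d =
  a ℕ.+ b ℕ.+ c ℕ.+ d ≤ n → P (+ a) (+ b) (+ c) (+ d) ≡ 0ℤ → ProductsPlusOneSquare a b c d

BoundedClaim-swap₁₂ : ∀ n a b c d → BoundedClaim n b a c d → BoundedClaim n a b c d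
BoundedClaim-swap₁₂ n a b c d claim sum≤n P≡0 = ProductsPlusOneSquare-swap₁₂ a b c d
  (claim (subst (_≤ n) (cong (λ s → s ℕ.+ c ℕ.+ d) (ℕ.+-comm a b)) sum≤n)
         (trans (sym (P-swap₁₂ (+ a) (+ b) (+ c) (+ d))) P≡0))

BoundedClaim-swap₂₃ : ∀ n a b c d → BoundedClaim n a c b d → BoundedClaim n a b c d
BoundedClaim-swap₂₃ n a b c d claim sum≤n P≡0 = ProductsPlusOneSquare-swap₂₃ a b c d
  (claim (subst (_≤ n) (cong (ℕ._+ d) (+-Semigroup.xy∙z≈xz∙y a b c)) sum≤n)
         (trans (sym (P-swap₂₃ (+ a) (+ b) (+ c) (+ d))) P≡0))

BoundedClaim-swap₃₄ : ∀ n a b c d → BoundedClaim n a b d c → BoundedClaim n a b c d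
BoundedClaim-swap₃₄ n a b c d claim sum≤n P≡0 = ProductsPlusOneSquare-swap₃₄ a b c d
  (claim (subst (_≤ n) (+-Semigroup.xy∙z≈xz∙y (a ℕ.+ b) c d) sum≤n)
         (trans (sym (P-swap₃₄ (+ a) (+ b) (+ c) (+ d))) P≡0))

descent-step : ∀ {n} → (∀ a b c d → BoundedClaim n a b c d) →
  ∀ {a b c d} → a ≤ b → b ≤ c → c ≤ d → BoundedClaim (suc n) a b c d
descent-step ih {zero} {b} {c} {d} _ _ _ _ P≡0 = ProductsPlusOneSquare-zero b c d P≡0
descent-step {n} ih {a@(suc _)} {b} {c} {d} a≤b b≤c c≤d sum≤1+n P≡0 =
  ProductsPlusOneSquare-jump a b c d e P≡0 Pe≡0 d+e≡ (ih a b c e sum′≤n Pe≡0)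
  where
  0<a : 0 < a
  0<a = ℕ.z<s
  d-root : IsRoot a b c d
  d-root = Equivalence.to (P≡0⇔IsRoot a b c d) P≡0
  e : ℕ
  e = 2 ℕ.* centre a b c ∸ d
  d+e≡ : d ℕ.+ e ≡ 2 ℕ.* centre a b c
  d+e≡ = ℕ.m+[n∸m]≡n (root≤2*centre a b c d
    0<a (ℕ.<-≤-trans 0<a a≤b) (ℕ.<-≤-trans 0<a (ℕ.≤-trans a≤b b≤c)) d-root)
  Pe≡0 : P (+ a) (+ b) (+ c) (+ e) ≡ 0ℤ
  Pe≡0 = Equivalence.from (P≡0⇔IsRoot a b c e) (other-root a b c d e d+e≡ d-root)
  e<d : e < d
  e<d = other-root<root a b c d e (ℕ.≤-trans a≤b b≤c) b≤c c≤d (IsRoot⇒product a b c d e d+e≡ d-root)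
  sum′≤n : a ℕ.+ b ℕ.+ c ℕ.+ e ≤ n
  sum′≤n = ℕ.≤-pred (ℕ.≤-trans (ℕ.+-monoʳ-< (a ℕ.+ b ℕ.+ c) e<d) sum≤1+n)

descent : ∀ n a b c d → BoundedClaim n a b c d
descent zero    zero    b c d _  P≡0 = ProductsPlusOneSquare-zero b c d P≡0
descent zero    (suc _) b c d () _
descent (suc n) = wlog-sorted (BoundedClaim (suc n))
  (BoundedClaim-swap₁₂ (suc n)) (BoundedClaim-swap₂₃ (suc n)) (BoundedClaim-swap₃₄ (suc n))
  (descent-step (descent n))

mainTheorem1 : (a b c d : ℕ) →
    P (+ a) (+ b) (+ c) (+ d) ≡ + 0 →
    IsSquare (+ a * + b + + 1) × IsSquare (+ a * + c + + 1) × IsSquare (+ a * + d + + 1) ×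
      IsSquare (+ b * + c + + 1) × IsSquare (+ b * + d + + 1) × IsSquare (+ c * + d + + 1)
mainTheorem1 a b c d = descent (a ℕ.+ b ℕ.+ c ℕ.+ d) a b c d ℕ.≤-refl
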